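{- Let $G$ be an abelian group, let $a\in G$ with $\mathrm{ord}(a)>2$, and let $S,T$ be nonempty sequences over $G$ with $|\mathrm{supp}(S)|\ge|\mathrm{supp}(T)|$. (1) If $\mathrm{supp}(S)-\mathrm{supp}(T)=\{0\}$, then $S=g^{|S|}$ and $T=g^{|T|}$ for some $g\in G$. (2) If $\mathrm{supp}(S)-\mathrm{supp}(T)\subset\{0,a\}$, then $S=g^{s}(g+a)^{|S|-s}$ and $T=g^{|T|}$ for some $g\in G$ and some $s\in[0,|S|]$. (3) If $|S|,|T|\ge2$ and $\bigcup_{i=1}^2(\Sigma_i(S)-\Sigma_i(T))\subset\{0,a\}$, then for some $g\in G$ either $S=g^{|S|-1}(g+a)$ and $T=g^{|T|}$, or $S=g^{|S|}$ and $T=g^{|T|}$.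
   Context: A sequence over $G$ is a finite unordered sequence $S=g_1\cdot\ldots\cdot g_l$ of elements of $G$ (element of the free abelian monoid on $G$), written multiplicatively ($g^k$ is $k$ copies of $g$); $|S|=l$ is its length, $\mathrm{supp}(S)=\{g_1,\dots,g_l\}$ its support, and for $k\in\mathbb N$, $\Sigma_k(S)=\{\sum_{i\in I}g_i: I\subset[1,l],\ |I|=k\}$ is the set of $k$-term subsums. For subsets $A,B\subset G$, $A-B=\{x-y:x\in A,y\in B\}$. $[a,b]=\{x\in\mathbb Z:a\le x\le b\}$. -}

module Defs where

open import Level using (_⊔_)
open import Algebra.Bundles using (AbelianGroup)
open import Data.Nat using (ℕ; zero; suc; _≤_)
open import Data.List using (List; []; _∷_; length; foldr)
open import Data.List.Relation.Unary.All using (All)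
open import Data.List.Relation.Unary.Any using (Any)
open import Data.List.Relation.Unary.AllPairs using (AllPairs)
open import Data.List.Membership.Propositional using (_∈_)
open import Data.List.Relation.Binary.Sublist.Propositional using () renaming (_⊆_ to _⊑_)
import Data.List.Relation.Binary.Permutation.Setoid as Perm
open import Data.Product using (Σ; _×_; ∃)
open import Relation.Nullary using (¬_)
open import Relation.Binary.PropositionalEquality using (_≡_)

module _ {c ℓ} (G : AbelianGroup c ℓ) where
  open AbelianGroup G

  diff : Carrier → Carrier → Carrier
  diff x y = x ∙ (y ⁻¹)

  times : ℕ → Carrier → Carrier
  times zero x = ε
  times (suc n) x = x ∙ times n x

  OrdGt2 : Carrier → Set ℓ
  OrdGt2 a = ∀ n → 1 ≤ n → n ≤ 2 → ¬ (times n a ≈ ε)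

  -- equality of sequences (elements of the free abelian monoid):
  -- equal up to reordering (and the group's equality)
  _≅_ : List Carrier → List Carrier → Set (c ⊔ ℓ)
  _≅_ = Perm._↭_ setoid

  _∈≈_ : Carrier → List Carrier → Set (c ⊔ ℓ)
  x ∈≈ S = Any (x ≈_) S

  -- D is a duplicate-free listing of supp(S), so |supp(S)| = length D
  IsSuppList : List Carrier → List Carrier → Set (c ⊔ ℓ)
  IsSuppList S D = AllPairs (λ x y → ¬ (x ≈ y)) D × All (_∈≈ S) D × All (_∈≈ D) S

  SuppGe : List Carrier → List Carrier → Set (c ⊔ ℓ)
  SuppGe S T = Σ (List Carrier) λ DS → Σ (List Carrier) λ DT →
    IsSuppList S DS × IsSuppList T DT × length DT ≤ length DS

  InSuppDiff : List Carrier → List Carrier → Carrier → Set (c ⊔ ℓ)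
  InSuppDiff S T z = Σ Carrier λ x → Σ Carrier λ y → x ∈ S × y ∈ T × z ≈ diff x y

  sumL : List Carrier → Carrier
  sumL = foldr _∙_ ε

  -- z ∈ Σ_k(S): sum over a k-element sub-multiset of positions (a sublist of length k)
  InΣ : ℕ → List Carrier → Carrier → Set (c ⊔ ℓ)
  InΣ k S z = Σ (List Carrier) λ U → U ⊑ S × length U ≡ k × z ≈ sumL U

  InΣDiff : ℕ → List Carrier → List Carrier → Carrier → Set (c ⊔ ℓ)
  InΣDiff k S T z = Σ Carrier λ x → Σ Carrier λ y → InΣ k S x × InΣ k T y × z ≈ diff x y

{-# OPTIONS --safe #-}
module Submission where

-- If every element of S lies in y + {0, a} for every y in T, then T is constant:
-- otherwise some y, y + a both occur in T, which pins S down to the single value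
-- y + a (the alternative y + 2a would give 2a = 0), so |supp S| = 1 < 2 ≤ |supp T|.
-- With T = g^|T| the elements of S are g or g + a, and for part (3) two copies of
-- g + a in S would put 2a into Σ₂(S) - Σ₂(T) ⊆ {0, a}.

open import Defs
open import Algebra.Bundles using (AbelianGroup)
import Algebra.Properties.AbelianGroup as AbelianGroupProperties
import Algebra.Properties.CommutativeSemigroup as CommutativeSemigroupProperties
import Relation.Binary.Reasoning.Setoid as SetoidReasoning
open import Data.Empty using (⊥; ⊥-elim)
open import Level using (_⊔_)
open import Data.List using (List; []; _∷_; length; replicate; _++_)
open import Data.List.Membership.Propositional using (_∈_)
open import Data.List.Relation.Binary.Sublist.Propositional
  using (_∷_; _∷ʳ_; minimum; from∈) renaming (_⊆_ to _⊑_)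
import Data.List.Relation.Binary.Permutation.Setoid as Permutation
import Data.List.Relation.Binary.Permutation.Setoid.Properties as PermutationProperties
open import Data.List.Relation.Unary.All as All using (All; []; _∷_)
open import Data.List.Relation.Unary.AllPairs using (AllPairs; []; _∷_)
open import Data.List.Relation.Unary.Any using (Any; here; there)
open import Data.Nat using (ℕ; suc; _≤_; _∸_; z≤n; s≤s)
open import Data.Nat.Properties using (≤-trans; +-∸-assoc; m≤n⇒m≤1+n; <-irrefl)
open import Data.Product using (Σ; _×_; _,_)
open import Data.Sum using (_⊎_; inj₁; inj₂; [_,_]) renaming (map to ⊎-map)
open import Function.Bundles using (_⇔_; Equivalence)
open import Relation.Nullary using (¬_)
open import Relation.Binary.PropositionalEquality using (_≡_; refl; subst) renaming (sym to ≡-sym)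

module _ {c ℓ} (G : AbelianGroup c ℓ) where
  open AbelianGroup G renaming (refl to ≈-refl)
  open AbelianGroupProperties G
  open CommutativeSemigroupProperties commutativeSemigroup using (interchange)
  open Permutation setoid using (_↭_; prep; ↭-refl; ↭-trans; ↭-sym)
  open PermutationProperties setoid using (↭-shift; ∷↭∷ʳ)

  diff≈⇒≈∙ : ∀ {x y z} → diff G x y ≈ z → x ≈ y ∙ z
  diff≈⇒≈∙ {x} {y} {z} d = trans (sym (//-rightDividesˡ y x)) (trans (∙-congʳ d) (comm z y))

  ∈⇒InΣ₁ : ∀ {x S} → x ∈ S → InΣ G 1 S x
  ∈⇒InΣ₁ {x} x∈S = x ∷ [] , from∈ x∈S , refl , sym (identityʳ x)

  All≈⇒↭replicate : ∀ {g} L → All (_≈ g) L → L ↭ replicate (length L) g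
  All≈⇒↭replicate []      []         = ↭-refl
  All≈⇒↭replicate (x ∷ L) (x≈g ∷ L≈g) = prep x≈g (All≈⇒↭replicate L L≈g)

  twoValued⇒↭replicate++replicate : ∀ {g b} L → All (λ x → x ≈ g ⊎ x ≈ b) L →
    Σ ℕ λ s → s ≤ length L × L ↭ replicate s g ++ replicate (length L ∸ s) b
  twoValued⇒↭replicate++replicate []      []              = 0 , z≤n , ↭-refl
  twoValued⇒↭replicate++replicate (x ∷ L) (inj₁ x≈g ∷ vs)
    with s , s≤|L| , L↭ ← twoValued⇒↭replicate++replicate L vs
    = suc s , s≤s s≤|L| , prep x≈g L↭
  twoValued⇒↭replicate++replicate {g} {b} (x ∷ L) (inj₂ x≈b ∷ vs)
    with s , s≤|L| , L↭ ← twoValued⇒↭replicate++replicate L vs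
    = s , m≤n⇒m≤1+n s≤|L| ,
      subst (λ n → x ∷ L ↭ replicate s g ++ replicate n b) (≡-sym (+-∸-assoc 1 s≤|L|))
            (↭-trans (prep x≈b L↭) (↭-sym (↭-shift (replicate s g) _)))

  twoValued-noRepeat⇒↭ : ∀ {g b} L → All (λ x → x ≈ g ⊎ x ≈ b) L →
    (∀ {u v} → u ∷ v ∷ [] ⊑ L → u ≈ b → v ≈ b → ⊥) →
    L ↭ replicate (length L ∸ 1) g ++ b ∷ [] ⊎ L ↭ replicate (length L) g
  twoValued-noRepeat⇒↭ []          []               _      = inj₂ ↭-refl
  twoValued-noRepeat⇒↭ (x ∷ [])    (inj₁ x≈g ∷ [])  _      = inj₂ (prep x≈g ↭-refl)
  twoValued-noRepeat⇒↭ (x ∷ y ∷ L) (inj₁ x≈g ∷ vs) noRep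
    with twoValued-noRepeat⇒↭ (y ∷ L) vs (λ sub → noRep (x ∷ʳ sub))
  ... | inj₁ yL↭ = inj₁ (prep x≈g yL↭)
  ... | inj₂ yL↭ = inj₂ (prep x≈g yL↭)
  twoValued-noRepeat⇒↭ {g} {b} (x ∷ L) (inj₂ x≈b ∷ vs) noRep =
    inj₁ (↭-trans (prep x≈b (All≈⇒↭replicate L L≈g)) (∷↭∷ʳ b (replicate (length L) g)))
    where
    L≈g : All (_≈ g) L
    L≈g = All.tabulate λ y∈L →
      [ (λ y≈g → y≈g) , (λ y≈b → ⊥-elim (noRep (refl ∷ from∈ y∈L) x≈b y≈b)) ] (All.lookup vs y∈L)

  distinct-All≈⇒length≤1 : ∀ {h} {D : List Carrier} →
    AllPairs (λ x y → ¬ (x ≈ y)) D → All (_≈ h) D → length D ≤ 1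
  distinct-All≈⇒length≤1 []                 _                  = z≤n
  distinct-All≈⇒length≤1 (_ ∷ [])           _                  = s≤s z≤n
  distinct-All≈⇒length≤1 ((x≉y ∷ _) ∷ _) (x≈h ∷ y≈h ∷ _) = ⊥-elim (x≉y (trans x≈h (sym y≈h)))

  ≉-members⇒2≤length : ∀ {u v} {D : List Carrier} →
    Any (u ≈_) D → Any (v ≈_) D → ¬ (u ≈ v) → 2 ≤ length D
  ≉-members⇒2≤length {D = _ ∷ _ ∷ _} _        _        _   = s≤s (s≤s z≤n)
  ≉-members⇒2≤length {D = _ ∷ []}    (here p) (here q) u≉v = ⊥-elim (u≉v (trans p (sym q)))

  suppGe-constant⇒¬≉ : ∀ {S T h y y′} → SuppGe G S T → All (_≈ h) S →
    y ∈ T → y′ ∈ T → ¬ (y ≈ y′) → ⊥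
  suppGe-constant⇒¬≉ (DS , DT , (DS-distinct , DS⊆S , _) , (_ , _ , T⊆DT) , |DT|≤|DS|) S≈h y∈T y′∈T y≉y′ =
    <-irrefl refl
      (≤-trans (≉-members⇒2≤length (All.lookup T⊆DT y∈T) (All.lookup T⊆DT y′∈T) y≉y′)
      (≤-trans |DT|≤|DS| (distinct-All≈⇒length≤1 DS-distinct DS≈h)))
    where
    DS≈h = All.map (All.lookupWith (λ x≈h d≈x → trans d≈x x≈h) S≈h) DS⊆S

  suppDiff≈ε⇒replicates : ∀ {S T x₀ y₀} → x₀ ∈ S → y₀ ∈ T →
    (∀ z → InSuppDiff G S T z ⇔ z ≈ ε) →
    Σ Carrier λ g → S ↭ replicate (length S) g × T ↭ replicate (length T) g
  suppDiff≈ε⇒replicates {S} {T} {x₀} {y₀} x₀∈S y₀∈T h =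
    y₀ , All≈⇒↭replicate S (All.tabulate λ x∈S → S≈T x∈S y₀∈T)
       , All≈⇒↭replicate T (All.tabulate λ y∈T → trans (sym (S≈T x₀∈S y∈T)) (S≈T x₀∈S y₀∈T))
    where
    S≈T : ∀ {x y} → x ∈ S → y ∈ T → x ≈ y
    S≈T x∈S y∈T = x∙y⁻¹≈ε⇒x≈y _ _ (Equivalence.to (h _) (_ , _ , x∈S , y∈T , ≈-refl))

  module _ (a : Carrier) where

    Shifted : Carrier → Carrier → Set ℓ
    Shifted x y = x ≈ y ⊎ x ≈ y ∙ a

    diff∈εa⇒Shifted : ∀ {x y} → diff G x y ≈ ε ⊎ diff G x y ≈ a → Shifted x y
    diff∈εa⇒Shifted {x} {y} (inj₁ d) = inj₁ (x∙y⁻¹≈ε⇒x≈y x y d)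
    diff∈εa⇒Shifted         (inj₂ d) = inj₂ (diff≈⇒≈∙ d)

    ShiftedFrom : List Carrier → List Carrier → Set (c ⊔ ℓ)
    ShiftedFrom S T = ∀ {x y} → x ∈ S → y ∈ T → Shifted x y

    suppDiff⊆εa⇒ShiftedFrom : ∀ {S T} → (∀ z → InSuppDiff G S T z → z ≈ ε ⊎ z ≈ a) → ShiftedFrom S T
    suppDiff⊆εa⇒ShiftedFrom h x∈S y∈T = diff∈εa⇒Shifted (h _ (_ , _ , x∈S , y∈T , ≈-refl))

    module _ (a≉ε : ¬ (a ≈ ε)) (a∙a≉ε : ¬ (a ∙ a ≈ ε)) where

      ¬Shifted-by-a∙a : ∀ {x y} → x ≈ y ∙ (a ∙ a) → ¬ Shifted x y
      ¬Shifted-by-a∙a {x} {y} x≈ (inj₁ x≈y)   = a∙a≉ε (identityʳ-unique y _ (trans (sym x≈) x≈y))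
      ¬Shifted-by-a∙a {x} {y} x≈ (inj₂ x≈y∙a) =
        a≉ε (identityʳ-unique a a (∙-cancelˡ y _ _ (trans (sym x≈) x≈y∙a)))

      module _ {S T} (S⇝T : ShiftedFrom S T) where

        ShiftedFrom-step⇒constant : ∀ {y y′} → y ∈ T → y′ ∈ T → y ∙ a ≈ y′ → All (_≈ y′) S
        ShiftedFrom-step⇒constant {y} {y′} y∈T y′∈T y∙a≈y′ = All.tabulate λ {x} x∈S →
          [ (λ x≈y′ → x≈y′)
          , (λ x≈y′∙a → ⊥-elim (¬Shifted-by-a∙a
                (trans x≈y′∙a (trans (∙-congʳ (sym y∙a≈y′)) (assoc y a a))) (S⇝T x∈S y∈T)))
          ] (S⇝T x∈S y′∈T)

        ShiftedFrom⇒constant : ∀ {x₀ y₀} → SuppGe G S T → x₀ ∈ S → y₀ ∈ T → All (_≈ y₀) T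
        ShiftedFrom⇒constant {x₀} {y₀} S≥T x₀∈S y₀∈T =
          All.tabulate λ y∈T → compare y∈T (S⇝T x₀∈S y∈T) (S⇝T x₀∈S y₀∈T)
          where
          ¬step : ∀ {y y′} → y ∈ T → y′ ∈ T → y ∙ a ≈ y′ → ⊥
          ¬step y∈T y′∈T y∙a≈y′ =
            suppGe-constant⇒¬≉ S≥T (ShiftedFrom-step⇒constant y∈T y′∈T y∙a≈y′) y∈T y′∈T
              λ y≈y′ → a≉ε (identityʳ-unique _ a (trans y∙a≈y′ (sym y≈y′)))
          compare : ∀ {y} → y ∈ T → Shifted x₀ y → Shifted x₀ y₀ → y ≈ y₀
          compare _   (inj₁ x₀≈y)   (inj₁ x₀≈y₀)   = trans (sym x₀≈y) x₀≈y₀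
          compare _   (inj₂ x₀≈y∙a) (inj₂ x₀≈y₀∙a) = ∙-cancelʳ a _ _ (trans (sym x₀≈y∙a) x₀≈y₀∙a)
          compare y∈T (inj₁ x₀≈y)   (inj₂ x₀≈y₀∙a) = ⊥-elim (¬step y₀∈T y∈T (trans (sym x₀≈y₀∙a) x₀≈y))
          compare y∈T (inj₂ x₀≈y∙a) (inj₁ x₀≈y₀)   = ⊥-elim (¬step y∈T y₀∈T (trans (sym x₀≈y∙a) x₀≈y₀))

      suppDiff⊆εa⇒replicates : ∀ {S T x₀ y₀} → SuppGe G S T → x₀ ∈ S → y₀ ∈ T →
        (∀ z → InSuppDiff G S T z → z ≈ ε ⊎ z ≈ a) →
        Σ Carrier λ g → Σ ℕ λ s → s ≤ length S
          × S ↭ replicate s g ++ replicate (length S ∸ s) (g ∙ a)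
          × T ↭ replicate (length T) g
      suppDiff⊆εa⇒replicates {S} {T} {y₀ = y₀} S≥T x₀∈S y₀∈T h
        with s , s≤|S| , S↭ ← twoValued⇒↭replicate++replicate S
                                 (All.tabulate λ x∈S → suppDiff⊆εa⇒ShiftedFrom h x∈S y₀∈T)
        = y₀ , s , s≤|S| , S↭
        , All≈⇒↭replicate T (ShiftedFrom⇒constant (suppDiff⊆εa⇒ShiftedFrom h) S≥T x₀∈S y₀∈T)

      subsumDiffs⊆εa⇒replicates : ∀ {S x₀} T → SuppGe G S T → x₀ ∈ S → 2 ≤ length T →
        (∀ z → InΣDiff G 1 S T z ⊎ InΣDiff G 2 S T z → z ≈ ε ⊎ z ≈ a) →
        Σ Carrier λ g → (S ↭ replicate (length S ∸ 1) g ++ (g ∙ a) ∷ [] × T ↭ replicate (length T) g)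
                      ⊎ (S ↭ replicate (length S) g × T ↭ replicate (length T) g)
      subsumDiffs⊆εa⇒replicates (_ ∷ []) _ _ (s≤s ()) _
      subsumDiffs⊆εa⇒replicates {S} T@(y₀ ∷ y₁ ∷ _) S≥T x₀∈S _ h =
        y₀ , ⊎-map (_, T↭) (_, T↭)
               (twoValued-noRepeat⇒↭ S (All.tabulate λ x∈S → S⇝T x∈S (here refl)) noRepeat)
        where
        S⇝T : ShiftedFrom S T
        S⇝T x∈S y∈T = diff∈εa⇒Shifted (h _ (inj₁ (_ , _ , ∈⇒InΣ₁ x∈S , ∈⇒InΣ₁ y∈T , ≈-refl)))
        T≈y₀ : All (_≈ y₀) T
        T≈y₀ = ShiftedFrom⇒constant S⇝T S≥T x₀∈S (here refl)
        T↭ : T ↭ replicate (length T) y₀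
        T↭ = All≈⇒↭replicate T T≈y₀
        noRepeat : ∀ {u v} → u ∷ v ∷ [] ⊑ S → u ≈ y₀ ∙ a → v ≈ y₀ ∙ a → ⊥
        noRepeat {u} {v} uv⊑S u≈ v≈ = ¬Shifted-by-a∙a uv≈y₀y₁∙a∙a
          (diff∈εa⇒Shifted (h _ (inj₂ (_ , _ , (u ∷ v ∷ [] , uv⊑S , refl , ≈-refl)
                                        , (y₀ ∷ y₁ ∷ [] , refl ∷ refl ∷ minimum _ , refl , ≈-refl) , ≈-refl))))
          where
          open SetoidReasoning setoid
          y₁≈y₀ : y₁ ≈ y₀
          y₁≈y₀ = All.lookup T≈y₀ (there (here refl))
          uv≈y₀y₁∙a∙a : u ∙ (v ∙ ε) ≈ (y₀ ∙ (y₁ ∙ ε)) ∙ (a ∙ a)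
          uv≈y₀y₁∙a∙a = begin
            u ∙ (v ∙ ε)               ≈⟨ ∙-cong u≈ (trans (identityʳ v) v≈) ⟩
            (y₀ ∙ a) ∙ (y₀ ∙ a)       ≈⟨ interchange y₀ a y₀ a ⟩
            (y₀ ∙ y₀) ∙ (a ∙ a)       ≈⟨ ∙-congʳ (∙-congˡ (sym (trans (identityʳ y₁) y₁≈y₀))) ⟩
            (y₀ ∙ (y₁ ∙ ε)) ∙ (a ∙ a) ∎

lemma3p4 : ∀ {c ℓ} (G : AbelianGroup c ℓ) → let open AbelianGroup G in
    (a : Carrier) → OrdGt2 G a →
    (S T : List Carrier) → ¬ (S ≡ []) → ¬ (T ≡ []) → SuppGe G S T →
    ((∀ z → InSuppDiff G S T z ⇔ z ≈ ε) →
       Σ Carrier λ g → _≅_ G S (replicate (length S) g) × _≅_ G T (replicate (length T) g))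
    × ((∀ z → InSuppDiff G S T z → z ≈ ε ⊎ z ≈ a) →
       Σ Carrier λ g → Σ ℕ λ s → s ≤ length S
         × _≅_ G S (replicate s g ++ replicate (length S ∸ s) (g ∙ a))
         × _≅_ G T (replicate (length T) g))
    × (2 ≤ length S → 2 ≤ length T →
       (∀ z → InΣDiff G 1 S T z ⊎ InΣDiff G 2 S T z → z ≈ ε ⊎ z ≈ a) →
       Σ Carrier λ g →
         (_≅_ G S (replicate (length S ∸ 1) g ++ (g ∙ a) ∷ []) × _≅_ G T (replicate (length T) g))
         ⊎ (_≅_ G S (replicate (length S) g) × _≅_ G T (replicate (length T) g)))
lemma3p4 G a ord []      _       S≢[] _    _ = ⊥-elim (S≢[] refl)
lemma3p4 G a ord (_ ∷ _) []      _    T≢[] _ = ⊥-elim (T≢[] refl)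
lemma3p4 G a ord (_ ∷ _) T@(_ ∷ _) _  _    S≥T =
    suppDiff≈ε⇒replicates G (here refl) (here refl)
  , suppDiff⊆εa⇒replicates G a a≉ε a∙a≉ε S≥T (here refl) (here refl)
  , λ _ → subsumDiffs⊆εa⇒replicates G a a≉ε a∙a≉ε T S≥T (here refl)
  where
  open AbelianGroup G using (_≈_; _∙_; ε; trans; identityʳ; ∙-congˡ)
  a≉ε : ¬ (a ≈ ε)
  a≉ε a≈ε = ord 1 (s≤s z≤n) (s≤s z≤n) (trans (identityʳ a) a≈ε)
  a∙a≉ε : ¬ (a ∙ a ≈ ε)
  a∙a≉ε a∙a≈ε = ord 2 (s≤s z≤n) (s≤s (s≤s z≤n)) (trans (∙-congˡ (identityʳ a)) a∙a≈ε)
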